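{- Let $n\geq 2$ and $m$ be integers with $1\leq m\leq \binom{n}{2}$, and let $L(n,m)$ be the lex graph with $n$ vertices and $m$ edges, of depth $k$, with $p_k$ as defined below. Then for every integer $r>2$, the number $i_r$ of independent sets of size $r$ in $L(n,m)$ is $$i_r=\binom{n-k-p_k}{r-1}+\binom{n-k}{r}.$$
   Context: For $A,B\subset \mathbb{N}$, $A$ precedes $B$ in lexicographic order if $\min(A\triangle B)\in A$. The lex graph $L(n,m)$ is the graph with vertex set $[n]=\{1,\ldots,n\}$ whose edge set consists of the first $m$ elements of $\binom{[n]}{2}$ (2-element subsets of $[n]$) in lexicographic order, i.e. $\{1,2\},\{1,3\},\ldots,\{1,n\},\{2,3\},\ldots,\{2,n\},\{3,4\},\ldots$. For $1\leq m\leq\binom{n}{2}$ there is a unique sequence $p_1,\ldots,p_k$ with $\sum_{i=1}^k p_i=m$, $p_i>0$, $1\leq k\leq n-1$, $p_i=n-i$ for $i<k$, and $p_k\in\{1,\ldots,n-k\}$. The number $k$ is the depth of $L(n,m)$; equivalently, $k$ is the smallest element of $\{1,\ldots,n-1\}$ with $m\leq \frac{k(2n-k-1)}{2}$, and $p_k=m-\frac{(k-1)(2n-k)}{2}$. -}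

module Defs where

open import Data.Bool using (Bool; true; false; _∧_; not)
open import Data.Nat using (ℕ; zero; suc; _<ᵇ_; _≡ᵇ_)
open import Data.Fin using (Fin; toℕ)
open import Data.Fin.Subset using (Subset; ∣_∣)
open import Data.Product using (_×_; _,_)
open import Data.List using (List; []; _∷_; map; filter; concatMap; allFin; take; length; _++_)
open import Data.Vec using (lookup; _∷_; [])
open import Data.Bool.Properties using (T?)

-- Vertices of a graph on [n] are represented by Fin n (vertex i ∈ [n] is the
-- element of Fin n with toℕ = i - 1).  A graph is given by its list of edges,
-- each edge {i,j} with i < j stored as the ordered pair (i , j).

pairsLex : (n : ℕ) → List (Fin n × Fin n)
pairsLex n = concatMap (λ i → map (λ j → (i , j))
                                  (filter (λ j → T? (toℕ i <ᵇ toℕ j)) (allFin n)))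
                       (allFin n)

lexGraph : (n m : ℕ) → List (Fin n × Fin n)
lexGraph n m = take m (pairsLex n)

allSubsets : (n : ℕ) → List (Subset n)
allSubsets zero = [] ∷ []
allSubsets (suc n) = map (true ∷_) (allSubsets n) ++ map (false ∷_) (allSubsets n)

allᵇ : {A : Set} → (A → Bool) → List A → Bool
allᵇ f [] = true
allᵇ f (x ∷ xs) = f x ∧ allᵇ f xs

isIndependent : {n : ℕ} → List (Fin n × Fin n) → Subset n → Bool
isIndependent E S = allᵇ (λ { (i , j) → not (lookup S i ∧ lookup S j) }) E

indepCount : {n : ℕ} → List (Fin n × Fin n) → ℕ → ℕ
indepCount {n} E r =
  length (filter (λ S → T? ((∣ S ∣ ≡ᵇ r) ∧ isIndependent E S)) (allSubsets n))

-- Vertex 1 of a lex graph of depth k ≥ 2 is adjacent to every other vertex, so it lies in no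
-- independent set of size ≥ 2, and deleting it leaves the lex graph L(n - 1, m - (n - 1)) of
-- depth k - 1.  After k - 1 such deletions one is left with a star joining vertex 1 to the
-- next p vertices of [n - k + 1]: its independent r-sets either avoid vertex 1
-- (C(n - k, r) of them) or consist of vertex 1 and r - 1 of the n - k - p non-neighbours.
module Submission where

open import Defs
open import Data.Bool using (Bool; true; false; _∧_; not; T)
open import Data.Bool.Properties using (T?; ∧-assoc; ∧-identityʳ; ∧-zeroʳ)
open import Data.Fin using (Fin; zero; suc; toℕ)
open import Data.Fin.Subset using (Subset; ∣_∣)
open import Data.List using (List; []; _∷_; map; filter; length; _++_; take; allFin; concatMap)
open import Data.List.Properties
  using (filter-++; filter-≐; filter-none; length-++; length-map; length-tabulate;
         map-∘; map-tabulate; concatMap-map; concatMap-cong; map-concatMap; take-map; take-all)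
open import Data.List.Relation.Unary.All using (universal)
open import Data.Nat using (ℕ; zero; suc; _+_; _*_; _∸_; _≤_; _<_; _≡ᵇ_; _<ᵇ_; s≤s; z≤n)
open import Data.Nat.Combinatorics using (_C_; nCk+nC[k+1]≡[n+1]C[k+1])
open import Data.Nat.Properties
  using (+-assoc; *-distribˡ-+; m+n∸m≡n; m+[n∸m]≡n; m∸n≤m; ≤-trans; ≤-reflexive;
         +-cancelʳ-≤; *-cancelˡ-≡; *-cancelˡ-≤; module ≤-Reasoning)
open import Data.Nat.Tactic.RingSolver using (solve-∀)
open import Data.Product as Product using (_×_; _,_; _,′_)
open import Data.Vec using (_∷_; []; lookup)
open import Function using (_∘_; id)
open import Level using (Level)
open import Relation.Nullary using (does)
open import Relation.Unary using (Pred; Decidable)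
open import Relation.Binary.PropositionalEquality
  using (_≡_; refl; sym; trans; cong; cong₂; subst; module ≡-Reasoning)

private
  variable
    a b ℓ : Level
    A : Set a
    B : Set b

filter-map : {P : Pred B ℓ} (P? : Decidable P) (f : A → B) (xs : List A) →
             filter P? (map f xs) ≡ map f (filter (P? ∘ f) xs)
filter-map P? f [] = refl
filter-map P? f (x ∷ xs) with does (P? (f x))
... | true  = cong (f x ∷_) (filter-map P? f xs)
... | false = filter-map P? f xs

take-++ : ∀ {k} m (xs ys : List A) → length xs ≡ k → take (k + m) (xs ++ ys) ≡ xs ++ take m ys
take-++ m []       ys refl = refl
take-++ m (x ∷ xs) ys refl = cong (x ∷_) (take-++ m xs ys refl)

take-++-≤ : ∀ m (xs ys : List A) → m ≤ length xs → take m (xs ++ ys) ≡ take m xs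
take-++-≤ zero    xs       ys _         = refl
take-++-≤ (suc m) (x ∷ xs) ys (s≤s m≤) = cong (x ∷_) (take-++-≤ m xs ys m≤)

allFin-suc : ∀ n → allFin (suc n) ≡ zero ∷ map suc (allFin n)
allFin-suc n = cong (zero ∷_) (sym (map-tabulate id suc))

allᵇ-++ : (f : A → Bool) (xs ys : List A) → allᵇ f (xs ++ ys) ≡ allᵇ f xs ∧ allᵇ f ys
allᵇ-++ f []       ys = refl
allᵇ-++ f (x ∷ xs) ys = trans (cong (f x ∧_) (allᵇ-++ f xs ys)) (sym (∧-assoc (f x) _ _))

allᵇ-map : (f : B → Bool) (g : A → B) (xs : List A) → allᵇ f (map g xs) ≡ allᵇ (f ∘ g) xs
allᵇ-map f g []       = refl
allᵇ-map f g (x ∷ xs) = cong (f (g x) ∧_) (allᵇ-map f g xs)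

countᵇ : (A → Bool) → List A → ℕ
countᵇ f xs = length (filter (T? ∘ f) xs)

countᵇ-++ : (f : A → Bool) (xs ys : List A) → countᵇ f (xs ++ ys) ≡ countᵇ f xs + countᵇ f ys
countᵇ-++ f xs ys = trans (cong length (filter-++ (T? ∘ f) xs ys)) (length-++ (filter (T? ∘ f) xs))

countᵇ-map : (f : B → Bool) (g : A → B) (xs : List A) → countᵇ f (map g xs) ≡ countᵇ (f ∘ g) xs
countᵇ-map f g xs = trans (cong length (filter-map (T? ∘ f) g xs)) (length-map g (filter (T? ∘ f ∘ g) xs))

countᵇ-cong : {f g : A → Bool} → (∀ x → f x ≡ g x) → (xs : List A) → countᵇ f xs ≡ countᵇ g xs
countᵇ-cong f≡g xs =
  cong length (filter-≐ (T? ∘ _) (T? ∘ _) ((λ {x} → subst T (f≡g x)) , (λ {x} → subst T (sym (f≡g x)))) xs)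

countᵇ-none : {f : A → Bool} → (∀ x → f x ≡ false) → (xs : List A) → countᵇ f xs ≡ 0
countᵇ-none f≡false xs = cong length (filter-none (T? ∘ _) (universal (λ x → subst T (f≡false x)) xs))

countᵇ-allSubsets-suc : ∀ n (f : Subset (suc n) → Bool) →
  countᵇ f (allSubsets (suc n)) ≡ countᵇ (f ∘ (true ∷_)) (allSubsets n) + countᵇ (f ∘ (false ∷_)) (allSubsets n)
countᵇ-allSubsets-suc n f = trans (countᵇ-++ f (map (true ∷_) (allSubsets n)) _)
  (cong₂ _+_ (countᵇ-map f (true ∷_) (allSubsets n)) (countᵇ-map f (false ∷_) (allSubsets n)))

countᵇ-size : ∀ n r → countᵇ (λ S → ∣ S ∣ ≡ᵇ r) (allSubsets n) ≡ n C r
countᵇ-size zero    zero    = refl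
countᵇ-size zero    (suc r) = refl
countᵇ-size (suc n) zero    =
  trans (countᵇ-allSubsets-suc n _) (cong₂ _+_ (countᵇ-none (λ _ → refl) (allSubsets n)) (countᵇ-size n zero))
countᵇ-size (suc n) (suc r) = begin
  countᵇ (λ S → ∣ S ∣ ≡ᵇ suc r) (allSubsets (suc n)) ≡⟨ countᵇ-allSubsets-suc n _ ⟩
  countᵇ (λ S → ∣ S ∣ ≡ᵇ r) (allSubsets n) + countᵇ (λ S → ∣ S ∣ ≡ᵇ suc r) (allSubsets n)
    ≡⟨ cong₂ _+_ (countᵇ-size n r) (countᵇ-size n (suc r)) ⟩
  n C r + n C suc r                                    ≡⟨ nCk+nC[k+1]≡[n+1]C[k+1] n r ⟩
  suc n C suc r                                        ∎
  where open ≡-Reasoning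

avoidsFirst : {n : ℕ} → ℕ → Subset n → Bool
avoidsFirst zero    S       = true
avoidsFirst (suc p) []      = true
avoidsFirst (suc p) (b ∷ S) = not b ∧ avoidsFirst p S

countᵇ-size-avoidsFirst : ∀ n p r → p ≤ n →
  countᵇ (λ S → (∣ S ∣ ≡ᵇ r) ∧ avoidsFirst p S) (allSubsets n) ≡ (n ∸ p) C r
countᵇ-size-avoidsFirst n zero r _ = trans (countᵇ-cong (λ S → ∧-identityʳ _) (allSubsets n)) (countᵇ-size n r)
countᵇ-size-avoidsFirst (suc n) (suc p) r (s≤s p≤n) = trans (countᵇ-allSubsets-suc n _)
  (cong₂ _+_ (countᵇ-none (λ S → ∧-zeroʳ _) (allSubsets n)) (countᵇ-size-avoidsFirst n p r p≤n))

nonempty∧avoidsAll≡false : ∀ {n} r (S : Subset n) → (∣ S ∣ ≡ᵇ suc r) ∧ avoidsFirst n S ≡ false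
nonempty∧avoidsAll≡false r []          = refl
nonempty∧avoidsAll≡false r (true ∷ S)  = ∧-zeroʳ _
nonempty∧avoidsAll≡false r (false ∷ S) = nonempty∧avoidsAll≡false r S

allᵇ-avoid-take : ∀ {n} p (S : Subset n) → allᵇ (not ∘ lookup S) (take p (allFin n)) ≡ avoidsFirst p S
allᵇ-avoid-take zero    S           = refl
allᵇ-avoid-take (suc p) []          = refl
allᵇ-avoid-take {suc n} (suc p) (b ∷ S) = begin
  allᵇ (not ∘ lookup (b ∷ S)) (take (suc p) (allFin (suc n)))
    ≡⟨ cong (allᵇ (not ∘ lookup (b ∷ S)) ∘ take (suc p)) (allFin-suc n) ⟩
  not b ∧ allᵇ (not ∘ lookup (b ∷ S)) (take p (map suc (allFin n)))
    ≡⟨ cong (λ js → not b ∧ allᵇ (not ∘ lookup (b ∷ S)) js) (take-map p (allFin n)) ⟩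
  not b ∧ allᵇ (not ∘ lookup (b ∷ S)) (map suc (take p (allFin n)))
    ≡⟨ cong (not b ∧_) (allᵇ-map (not ∘ lookup (b ∷ S)) suc (take p (allFin n))) ⟩
  not b ∧ allᵇ (not ∘ lookup S) (take p (allFin n))
    ≡⟨ cong (not b ∧_) (allᵇ-avoid-take p S) ⟩
  not b ∧ avoidsFirst p S
    ∎
  where open ≡-Reasoning

star : {n : ℕ} → List (Fin n) → List (Fin (suc n) × Fin (suc n))
star = map (λ j → zero , suc j)

shift : {n : ℕ} → List (Fin n × Fin n) → List (Fin (suc n) × Fin (suc n))
shift = map (Product.map suc suc)

isIndependent-++ : ∀ {n} (E F : List (Fin n × Fin n)) S →
  isIndependent (E ++ F) S ≡ isIndependent E S ∧ isIndependent F S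
isIndependent-++ E F S = allᵇ-++ _ E F

isIndependent-shift : ∀ {n} (E : List (Fin n × Fin n)) b S → isIndependent (shift E) (b ∷ S) ≡ isIndependent E S
isIndependent-shift []            b S = refl
isIndependent-shift ((i , j) ∷ E) b S = cong (not (lookup S i ∧ lookup S j) ∧_) (isIndependent-shift E b S)

isIndependent-star-outside : ∀ {n} (js : List (Fin n)) S → isIndependent (star js) (false ∷ S) ≡ true
isIndependent-star-outside []       S = refl
isIndependent-star-outside (j ∷ js) S = isIndependent-star-outside js S

isIndependent-star-inside : ∀ {n} p (S : Subset n) →
  isIndependent (star (take p (allFin n))) (true ∷ S) ≡ avoidsFirst p S
isIndependent-star-inside p S = trans (allᵇ-map _ _ (take p (allFin _))) (allᵇ-avoid-take p S)

indepCount-star : ∀ {n} p r → p ≤ n →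
  indepCount (star (take p (allFin n))) (suc r) ≡ (n ∸ p) C r + n C suc r
indepCount-star {n} p r p≤n = trans (countᵇ-allSubsets-suc n _) (cong₂ _+_
  (trans (countᵇ-cong (λ S → cong ((∣ S ∣ ≡ᵇ r) ∧_) (isIndependent-star-inside p S)) (allSubsets n))
         (countᵇ-size-avoidsFirst n p r p≤n))
  (trans (countᵇ-cong (λ S → trans (cong ((∣ S ∣ ≡ᵇ suc r) ∧_) (isIndependent-star-outside (take p (allFin n)) S)) (∧-identityʳ _))
                      (allSubsets n))
         (countᵇ-size n (suc r))))

indepCount-cone : ∀ {n} (E : List (Fin n × Fin n)) r →
  indepCount (star (allFin n) ++ shift E) (2 + r) ≡ indepCount E (2 + r)
indepCount-cone {n} E r = trans (countᵇ-allSubsets-suc n _)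
  (cong₂ _+_ (countᵇ-none apex-excluded (allSubsets n)) (countᵇ-cong apex-absent (allSubsets n)))
  where
  open ≡-Reasoning
  star-inside : ∀ S → isIndependent (star (allFin n)) (true ∷ S) ≡ avoidsFirst n S
  star-inside S = subst (λ js → isIndependent (star js) (true ∷ S) ≡ avoidsFirst n S)
                        (take-all n (allFin n) (≤-reflexive (length-tabulate id)))
                        (isIndependent-star-inside n S)
  apex-excluded : ∀ S → (∣ S ∣ ≡ᵇ suc r) ∧ isIndependent (star (allFin n) ++ shift E) (true ∷ S) ≡ false
  apex-excluded S = begin
    (∣ S ∣ ≡ᵇ suc r) ∧ isIndependent (star (allFin n) ++ shift E) (true ∷ S)
      ≡⟨ cong ((∣ S ∣ ≡ᵇ suc r) ∧_) (isIndependent-++ (star (allFin n)) (shift E) (true ∷ S)) ⟩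
    (∣ S ∣ ≡ᵇ suc r) ∧ (isIndependent (star (allFin n)) (true ∷ S) ∧ isIndependent (shift E) (true ∷ S))
      ≡⟨ cong ((∣ S ∣ ≡ᵇ suc r) ∧_) (cong₂ _∧_ (star-inside S) (isIndependent-shift E true S)) ⟩
    (∣ S ∣ ≡ᵇ suc r) ∧ (avoidsFirst n S ∧ isIndependent E S)
      ≡⟨ sym (∧-assoc (∣ S ∣ ≡ᵇ suc r) _ _) ⟩
    ((∣ S ∣ ≡ᵇ suc r) ∧ avoidsFirst n S) ∧ isIndependent E S
      ≡⟨ cong (_∧ isIndependent E S) (nonempty∧avoidsAll≡false r S) ⟩
    false
      ∎
  apex-absent : ∀ S → (∣ S ∣ ≡ᵇ 2 + r) ∧ isIndependent (star (allFin n) ++ shift E) (false ∷ S)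
                    ≡ (∣ S ∣ ≡ᵇ 2 + r) ∧ isIndependent E S
  apex-absent S = cong ((∣ S ∣ ≡ᵇ 2 + r) ∧_) (begin
    isIndependent (star (allFin n) ++ shift E) (false ∷ S)
      ≡⟨ isIndependent-++ (star (allFin n)) (shift E) (false ∷ S) ⟩
    isIndependent (star (allFin n)) (false ∷ S) ∧ isIndependent (shift E) (false ∷ S)
      ≡⟨ cong₂ _∧_ (isIndependent-star-outside (allFin n) S) (isIndependent-shift E false S) ⟩
    isIndependent E S
      ∎)

above : {n : ℕ} → Fin n → List (Fin n) → List (Fin n)
above i = filter (λ j → T? (toℕ i <ᵇ toℕ j))

row : (n : ℕ) → Fin n → List (Fin n × Fin n)
row n i = map (i ,_) (above i (allFin n))

above-zero : ∀ {n} (js : List (Fin n)) → above zero (map suc js) ≡ map suc js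
above-zero []       = refl
above-zero (j ∷ js) = cong (suc j ∷_) (above-zero js)

row-zero : ∀ n → row (suc n) zero ≡ star (allFin n)
row-zero n = begin
  map (zero ,′_) (above zero (allFin (suc n)))    ≡⟨ cong (map (zero ,′_) ∘ above zero) (allFin-suc n) ⟩
  map (zero ,′_) (above zero (map suc (allFin n))) ≡⟨ cong (map (zero ,′_)) (above-zero (allFin n)) ⟩
  map (zero ,′_) (map suc (allFin n))             ≡⟨ map-∘ (allFin n) ⟨
  star (allFin n)                                ∎
  where open ≡-Reasoning

row-suc : ∀ n i → row (suc n) (suc i) ≡ shift (row n i)
row-suc n i = begin
  map (suc i ,′_) (above (suc i) (allFin (suc n)))     ≡⟨ cong (map (suc i ,′_) ∘ above (suc i)) (allFin-suc n) ⟩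
  map (suc i ,′_) (above (suc i) (map suc (allFin n))) ≡⟨ cong (map (suc i ,′_)) (filter-map (λ j → T? (toℕ (suc i) <ᵇ toℕ j)) suc (allFin n)) ⟩
  map (suc i ,′_) (map suc (above i (allFin n)))       ≡⟨ map-∘ {g = suc i ,_} {f = suc} (above i (allFin n)) ⟨
  map ((suc i ,′_) ∘ suc) (above i (allFin n))         ≡⟨ map-∘ {g = Product.map suc suc} {f = i ,′_} (above i (allFin n)) ⟩
  shift (row n i)                                     ∎
  where open ≡-Reasoning

pairsLex-suc : ∀ n → pairsLex (suc n) ≡ star (allFin n) ++ shift (pairsLex n)
pairsLex-suc n = begin
  concatMap (row (suc n)) (allFin (suc n))                       ≡⟨ cong (concatMap (row (suc n))) (allFin-suc n) ⟩
  row (suc n) zero ++ concatMap (row (suc n)) (map suc (allFin n)) ≡⟨ cong₂ _++_ (row-zero n) (begin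
    concatMap (row (suc n)) (map suc (allFin n))                   ≡⟨ concatMap-map (row (suc n)) suc (allFin n) ⟩
    concatMap (row (suc n) ∘ suc) (allFin n)                       ≡⟨ concatMap-cong (row-suc n) (allFin n) ⟩
    concatMap (shift ∘ row n) (allFin n)                           ≡⟨ map-concatMap _ (row n) (allFin n) ⟨
    shift (pairsLex n)                                             ∎) ⟩
  star (allFin n) ++ shift (pairsLex n)                          ∎
  where open ≡-Reasoning

length-star-allFin : ∀ n → length (star (allFin n)) ≡ n
length-star-allFin n = trans (length-map _ (allFin n)) (length-tabulate id)

lexGraph-star : ∀ {n} p → p ≤ n → lexGraph (suc n) p ≡ star (take p (allFin n))
lexGraph-star {n} p p≤n = begin
  take p (pairsLex (suc n))                        ≡⟨ cong (take p) (pairsLex-suc n) ⟩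
  take p (star (allFin n) ++ shift (pairsLex n))   ≡⟨ take-++-≤ p _ _ (subst (p ≤_) (sym (length-star-allFin n)) p≤n) ⟩
  take p (star (allFin n))                         ≡⟨ take-map p (allFin n) ⟩
  star (take p (allFin n))                         ∎
  where open ≡-Reasoning

lexGraph-cone : ∀ n m → lexGraph (suc n) (n + m) ≡ star (allFin n) ++ shift (lexGraph n m)
lexGraph-cone n m = begin
  take (n + m) (pairsLex (suc n))                        ≡⟨ cong (take (n + m)) (pairsLex-suc n) ⟩
  take (n + m) (star (allFin n) ++ shift (pairsLex n))   ≡⟨ take-++ m _ _ (length-star-allFin n) ⟩
  star (allFin n) ++ take m (shift (pairsLex n))         ≡⟨ cong (star (allFin n) ++_) (take-map m (pairsLex n)) ⟩
  star (allFin n) ++ shift (lexGraph n m)                ∎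
  where open ≡-Reasoning

-- ∑_{i=1}^{j} (n - i) = j(2n - j - 1)/2, the number of pairs in the first j rows of the lex order on [n].
rowsSize : ℕ → ℕ → ℕ
rowsSize n       zero    = 0
rowsSize zero    (suc j) = 0
rowsSize (suc n) (suc j) = n + rowsSize n j

indepCount-lexGraph : ∀ j e p r → p ≤ e →
  indepCount (lexGraph (suc j + e) (rowsSize (suc j + e) j + p)) (2 + r) ≡ (e ∸ p) C (1 + r) + e C (2 + r)
indepCount-lexGraph zero e p r p≤e =
  trans (cong (λ E → indepCount E (2 + r)) (lexGraph-star p p≤e)) (indepCount-star p (suc r) p≤e)
indepCount-lexGraph (suc j) e p r p≤e = begin
  indepCount (lexGraph (suc n) ((n + rowsSize n j) + p)) (2 + r)
    ≡⟨ cong (λ m → indepCount (lexGraph (suc n) m) (2 + r)) (+-assoc n (rowsSize n j) p) ⟩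
  indepCount (lexGraph (suc n) (n + (rowsSize n j + p))) (2 + r)
    ≡⟨ cong (λ E → indepCount E (2 + r)) (lexGraph-cone n (rowsSize n j + p)) ⟩
  indepCount (star (allFin n) ++ shift (lexGraph n (rowsSize n j + p))) (2 + r)
    ≡⟨ indepCount-cone (lexGraph n (rowsSize n j + p)) r ⟩
  indepCount (lexGraph n (rowsSize n j + p)) (2 + r)
    ≡⟨ indepCount-lexGraph j e p r p≤e ⟩
  (e ∸ p) C (1 + r) + e C (2 + r)
    ∎
  where
  open ≡-Reasoning
  n = suc j + e

twice-rowsSize : ∀ j e → 2 * rowsSize (suc j + e) j ≡ j * suc (j + 2 * e)
twice-rowsSize zero    e = refl
twice-rowsSize (suc j) e = begin
  2 * (suc (j + e) + rowsSize (suc j + e) j)       ≡⟨ *-distribˡ-+ 2 (suc (j + e)) _ ⟩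
  2 * suc (j + e) + 2 * rowsSize (suc j + e) j     ≡⟨ cong (2 * suc (j + e) +_) (twice-rowsSize j e) ⟩
  2 * suc (j + e) + j * suc (j + 2 * e)            ≡⟨ next-row j e ⟩
  suc j * suc (suc j + 2 * e)                      ∎
  where
  open ≡-Reasoning
  next-row : ∀ j e → 2 * suc (j + e) + j * suc (j + 2 * e) ≡ suc j * suc (suc j + 2 * e)
  next-row = solve-∀

twice-minus : ∀ j e → 2 * (suc j + e) ∸ suc j ≡ suc (j + 2 * e)
twice-minus j e = trans (cong (_∸ suc j) (split j e)) (m+n∸m≡n (suc j) _)
  where
  split : ∀ j e → 2 * (suc j + e) ≡ suc j + suc (j + 2 * e)
  split = solve-∀

module LexDepth (j e m p : ℕ) (eq : 2 * p + j * (2 * (suc j + e) ∸ suc j) ≡ 2 * m) where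

  twice-edges : 2 * p + 2 * rowsSize (suc j + e) j ≡ 2 * m
  twice-edges = trans (cong (2 * p +_) (twice-rowsSize j e))
                      (trans (cong (λ x → 2 * p + j * x) (sym (twice-minus j e))) eq)

  edges : m ≡ rowsSize (suc j + e) j + p
  edges = *-cancelˡ-≡ m _ 2 (begin
    2 * m                                  ≡⟨ sym twice-edges ⟩
    2 * p + 2 * rowsSize (suc j + e) j     ≡⟨ swap p (rowsSize (suc j + e) j) ⟩
    2 * (rowsSize (suc j + e) j + p)       ∎)
    where
    open ≡-Reasoning
    swap : ∀ p s → 2 * p + 2 * s ≡ 2 * (s + p)
    swap = solve-∀

  last-row : 2 * m ≤ suc j * (2 * (suc j + e) ∸ suc j ∸ 1) → p ≤ e
  last-row bound = *-cancelˡ-≤ 2 (+-cancelʳ-≤ (2 * rowsSize (suc j + e) j) (2 * p) (2 * e) (begin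
    2 * p + 2 * rowsSize (suc j + e) j        ≡⟨ twice-edges ⟩
    2 * m                                     ≤⟨ bound ⟩
    suc j * (2 * (suc j + e) ∸ suc j ∸ 1)     ≡⟨ cong (λ x → suc j * (x ∸ 1)) (twice-minus j e) ⟩
    suc j * (j + 2 * e)                       ≡⟨ full-row j e ⟩
    2 * e + j * suc (j + 2 * e)               ≡⟨ cong (2 * e +_) (sym (twice-rowsSize j e)) ⟩
    2 * e + 2 * rowsSize (suc j + e) j        ∎))
    where
    open ≤-Reasoning
    full-row : ∀ j e → suc j * (j + 2 * e) ≡ 2 * e + j * suc (j + 2 * e)
    full-row = solve-∀

theorem6 : (n m k p r : ℕ) → 2 ≤ n → 1 ≤ m → m ≤ n C 2
    → 1 ≤ k → k ≤ n ∸ 1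
    → 2 * m ≤ k * (2 * n ∸ k ∸ 1)
    → (∀ k′ → 1 ≤ k′ → k′ < k → k′ * (2 * n ∸ k′ ∸ 1) < 2 * m)
    → 2 * p + (k ∸ 1) * (2 * n ∸ k) ≡ 2 * m
    → 2 < r
    → indepCount (lexGraph n m) r ≡ (n ∸ k ∸ p) C (r ∸ 1) + (n ∸ k) C r
theorem6 n m (suc j) p r _ _ _ (s≤s z≤n) k≤n-1 bound _ eq (s≤s (s≤s _))
  with n ∸ suc j | m+[n∸m]≡n (≤-trans k≤n-1 (m∸n≤m n 1))
... | e | refl =
  subst (λ m → indepCount (lexGraph (suc j + e) m) r ≡ (e ∸ p) C (r ∸ 1) + e C r)
        (sym edges) (indepCount-lexGraph j e p _ (last-row bound))
  where open LexDepth j e m p eq
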